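{- Let $P$ be a functional Pure Type System and let $\Pi x:A~B$ be a well-typed term of $P$ (in some context). Then $\|\Pi x:A~B\|\equiv_P \Pi x:\|A\|~\|B\|$.
   Context: A Pure Type System $P=\langle S,A,R\rangle$ has sorts $S$, axioms $A\subseteq S\times S$, rules $R\subseteq S\times S\times S$ and the usual PTS typing rules; it is functional if $\langle s_1,s_2\rangle,\langle s_1,s_3\rangle\in A$ implies $s_2=s_3$ and $\langle s_1,s_2,s_3\rangle,\langle s_1,s_2,s_4\rangle\in R$ implies $s_3=s_4$. $\Sigma_P$ declares, for each sort $s$, $U_s:Type$, $\varepsilon_s:U_s\Rightarrow Type$; for each axiom $\langle s_1,s_2\rangle$, $\dot{s_1}:U_{s_2}$; for each rule $\langle s_1,s_2,s_3\rangle$, $\dot\Pi_{\langle s_1,s_2,s_3\rangle}:\Pi X:U_{s_1}~(((\varepsilon_{s_1}~X)\Rightarrow U_{s_2})\Rightarrow U_{s_3})$. $\equiv_P$ is the congruence on $\lambda\Pi$-terms generated by $\beta$ and the rewrite rules $\varepsilon_{s_2}~\dot{s_1}\longrightarrow U_{s_1}$ (axioms) and $\varepsilon_{s_3}(\dot\Pi_{\langle s_1,s_2,s_3\rangle}~X~Y)\longrightarrow \Pi x:(\varepsilon_{s_1}~X)~(\varepsilon_{s_2}~(Y~x))$ (rules). Translation of $t$ well-typed in $P$: $|x|=x$; $|s|=\dot s$; $|\Pi x:A~B|=\dot\Pi_{\langle s_1,s_2,s_3\rangle}~|A|~(\lambda x:(\varepsilon_{s_1}~|A|)~|B|)$ with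 $s_1,s_2,s_3$ the types of $A$, $B$, $\Pi x:A~B$; $|\lambda x:A~t|=\lambda x:(\varepsilon_s~|A|)~|t|$ with $s$ the type of $A$; $|t~u|=|t|~|u|$. For $A$ of type a sort $s$, $\|A\|=\varepsilon_s~|A|$; for a non-typable sort $s'$, $\|s'\|=U_{s'}$. -}

module Defs where

open import Data.Nat using (ℕ; zero; suc)
open import Data.List using (List; []; _∷_)
open import Data.Product using (_×_)
open import Relation.Nullary using (¬_)
open import Relation.Binary.PropositionalEquality using (_≡_)
open import Relation.Binary.Construct.Closure.Equivalence using (EqClosure)

record PTS : Set₁ where
  field
    Sort : Set
    Ax   : Sort → Sort → Set
    Rl   : Sort → Sort → Sort → Set

Functional : PTS → Set
Functional P =
  (∀ {s1 s2 s3} → Ax s1 s2 → Ax s1 s3 → s2 ≡ s3) ×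
  (∀ {s1 s2 s3 s4} → Rl s1 s2 s3 → Rl s1 s2 s4 → s3 ≡ s4)
  where open PTS P

-- Everything below is relative to a fixed PTS P.
-- De Bruijn indices; context = list of types, head = most recent binder.

module PTSDefs (P : PTS) where
  open PTS P

  ext : (ℕ → ℕ) → ℕ → ℕ
  ext ρ zero    = zero
  ext ρ (suc n) = suc (ρ n)

  data Tm : Set where
    var : ℕ → Tm
    srt : Sort → Tm
    Pi  : Tm → Tm → Tm
    lam : Tm → Tm → Tm
    app : Tm → Tm → Tm

  ren : (ℕ → ℕ) → Tm → Tm
  ren ρ (var n)   = var (ρ n)
  ren ρ (srt s)   = srt s
  ren ρ (Pi A B)  = Pi (ren ρ A) (ren (ext ρ) B)
  ren ρ (lam A t) = lam (ren ρ A) (ren (ext ρ) t)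
  ren ρ (app t u) = app (ren ρ t) (ren ρ u)

  wk : Tm → Tm
  wk = ren suc

  exts : (ℕ → Tm) → ℕ → Tm
  exts σ zero    = var zero
  exts σ (suc n) = wk (σ n)

  sub : (ℕ → Tm) → Tm → Tm
  sub σ (var n)   = σ n
  sub σ (srt s)   = srt s
  sub σ (Pi A B)  = Pi (sub σ A) (sub (exts σ) B)
  sub σ (lam A t) = lam (sub σ A) (sub (exts σ) t)
  sub σ (app t u) = app (sub σ t) (sub σ u)

  sub0 : Tm → ℕ → Tm
  sub0 u zero    = u
  sub0 u (suc n) = var n

  _[_] : Tm → Tm → Tm
  t [ u ] = sub (sub0 u) t

  data _→β_ : Tm → Tm → Set where
    β     : ∀ {A t u} → app (lam A t) u →β (t [ u ])
    Piˡ   : ∀ {A A' B} → A →β A' → Pi A B →β Pi A' B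
    Piʳ   : ∀ {A B B'} → B →β B' → Pi A B →β Pi A B'
    lamˡ  : ∀ {A A' t} → A →β A' → lam A t →β lam A' t
    lamʳ  : ∀ {A t t'} → t →β t' → lam A t →β lam A t'
    appˡ  : ∀ {t t' u} → t →β t' → app t u →β app t' u
    appʳ  : ∀ {t u u'} → u →β u' → app t u →β app t u'

  _=β_ : Tm → Tm → Set
  _=β_ = EqClosure _→β_

  Ctx : Set
  Ctx = List Tm

  data _⊢_∶_ : Ctx → Tm → Tm → Set where
    ⊢ax    : ∀ {s1 s2} → Ax s1 s2 → [] ⊢ srt s1 ∶ srt s2
    ⊢start : ∀ {Γ A s} → Γ ⊢ A ∶ srt s → (A ∷ Γ) ⊢ var zero ∶ wk A
    ⊢weak  : ∀ {Γ t T C s} → Γ ⊢ t ∶ T → Γ ⊢ C ∶ srt s → (C ∷ Γ) ⊢ wk t ∶ wk T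
    ⊢prod  : ∀ {Γ A B s1 s2 s3} → Rl s1 s2 s3 →
             Γ ⊢ A ∶ srt s1 → (A ∷ Γ) ⊢ B ∶ srt s2 → Γ ⊢ Pi A B ∶ srt s3
    ⊢app   : ∀ {Γ f u A B} → Γ ⊢ f ∶ Pi A B → Γ ⊢ u ∶ A → Γ ⊢ app f u ∶ (B [ u ])
    ⊢abs   : ∀ {Γ A B t s} → (A ∷ Γ) ⊢ t ∶ B → Γ ⊢ Pi A B ∶ srt s → Γ ⊢ lam A t ∶ Pi A B
    ⊢conv  : ∀ {Γ t T T' s} → Γ ⊢ t ∶ T → Γ ⊢ T' ∶ srt s → T =β T' → Γ ⊢ t ∶ T'

  data LTm : Set where
    v    : ℕ → LTm
    Ty   : LTm
    Kd   : LTm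
    cU   : Sort → LTm
    cε   : Sort → LTm
    cdot : Sort → LTm
    cΠ   : Sort → Sort → Sort → LTm
    LPi  : LTm → LTm → LTm
    Llam : LTm → LTm → LTm
    _·_  : LTm → LTm → LTm

  infixl 7 _·_
  infix 4 _⟶_

  Lren : (ℕ → ℕ) → LTm → LTm
  Lren ρ (v n)      = v (ρ n)
  Lren ρ Ty         = Ty
  Lren ρ Kd         = Kd
  Lren ρ (cU s)     = cU s
  Lren ρ (cε s)     = cε s
  Lren ρ (cdot s)   = cdot s
  Lren ρ (cΠ a b c) = cΠ a b c
  Lren ρ (LPi A B)  = LPi (Lren ρ A) (Lren (ext ρ) B)
  Lren ρ (Llam A t) = Llam (Lren ρ A) (Lren (ext ρ) t)
  Lren ρ (t · u)    = Lren ρ t · Lren ρ u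

  Lwk : LTm → LTm
  Lwk = Lren suc

  Lexts : (ℕ → LTm) → ℕ → LTm
  Lexts σ zero    = v zero
  Lexts σ (suc n) = Lwk (σ n)

  Lsub : (ℕ → LTm) → LTm → LTm
  Lsub σ (v n)      = σ n
  Lsub σ Ty         = Ty
  Lsub σ Kd         = Kd
  Lsub σ (cU s)     = cU s
  Lsub σ (cε s)     = cε s
  Lsub σ (cdot s)   = cdot s
  Lsub σ (cΠ a b c) = cΠ a b c
  Lsub σ (LPi A B)  = LPi (Lsub σ A) (Lsub (Lexts σ) B)
  Lsub σ (Llam A t) = Llam (Lsub σ A) (Lsub (Lexts σ) t)
  Lsub σ (t · u)    = Lsub σ t · Lsub σ u

  Lsub0 : LTm → ℕ → LTm
  Lsub0 u zero    = u
  Lsub0 u (suc n) = v n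

  _⟦_⟧ : LTm → LTm → LTm
  t ⟦ u ⟧ = Lsub (Lsub0 u) t

  data _⟶_ : LTm → LTm → Set where
    βL    : ∀ {A t u} → Llam A t · u ⟶ (t ⟦ u ⟧)
    rAx   : ∀ {s1 s2} → Ax s1 s2 → cε s2 · cdot s1 ⟶ cU s1
    rRl   : ∀ {s1 s2 s3 X Y} → Rl s1 s2 s3 →
            cε s3 · (cΠ s1 s2 s3 · X · Y) ⟶
            LPi (cε s1 · X) (cε s2 · (Lwk Y · v zero))
    LPiˡ  : ∀ {A A' B} → A ⟶ A' → LPi A B ⟶ LPi A' B
    LPiʳ  : ∀ {A B B'} → B ⟶ B' → LPi A B ⟶ LPi A B'
    Llamˡ : ∀ {A A' t} → A ⟶ A' → Llam A t ⟶ Llam A' t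
    Llamʳ : ∀ {A t t'} → t ⟶ t' → Llam A t ⟶ Llam A t'
    ·ˡ    : ∀ {t t' u} → t ⟶ t' → t · u ⟶ t' · u
    ·ʳ    : ∀ {t u u'} → u ⟶ u' → t · u ⟶ t · u'

  _≡P_ : LTm → LTm → Set
  _≡P_ = EqClosure _⟶_

  -- The translation |t|, as a relation  Tr Γ t t'  ("t' = |t|"),
  -- reading off the sorts from typing judgements in Γ.

  data Tr : Ctx → Tm → LTm → Set where
    trVar : ∀ {Γ n} → Tr Γ (var n) (v n)
    trSrt : ∀ {Γ s} → Tr Γ (srt s) (cdot s)
    trPi  : ∀ {Γ A B a b s1 s2 s3} →
            Γ ⊢ A ∶ srt s1 → (A ∷ Γ) ⊢ B ∶ srt s2 → Γ ⊢ Pi A B ∶ srt s3 →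
            Tr Γ A a → Tr (A ∷ Γ) B b →
            Tr Γ (Pi A B) (cΠ s1 s2 s3 · a · Llam (cε s1 · a) b)
    trLam : ∀ {Γ A t a t' s} →
            Γ ⊢ A ∶ srt s → Tr Γ A a → Tr (A ∷ Γ) t t' →
            Tr Γ (lam A t) (Llam (cε s · a) t')
    trApp : ∀ {Γ t u t' u'} → Tr Γ t t' → Tr Γ u u' → Tr Γ (app t u) (t' · u')

  data Norm : Ctx → Tm → LTm → Set where
    nmTy  : ∀ {Γ A a s} → Γ ⊢ A ∶ srt s → Tr Γ A a → Norm Γ A (cε s · a)
    nmSrt : ∀ {Γ s} → (∀ s' → ¬ Ax s s') → Norm Γ (srt s) (cU s)

{-# OPTIONS --safe #-}
-- ‖Π x:A B‖ is ε_{s₃} (Π̇ |A| (λ x:‖A‖. |B|)); the rewrite rule of ⟨s₁,s₂,s₃⟩ turns it into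
-- Π x:‖A‖. ε_{s₂} ((λ x:‖A‖. |B|) x), and one β-step gives Π x:‖A‖. ‖B‖. What has to be shown is
-- that the sorts recorded by the three translations agree and that ⟨s₁,s₂,s₃⟩ really is a rule.
-- Both follow from uniqueness of types in a functional PTS: types are unique up to β-conversion,
-- and by Church–Rosser (Tait–Martin-Löf parallel reduction) distinct sorts are not convertible.
-- Uniqueness also excludes that A or B is an untypable sort.
module Submission where

open import Defs
open import Data.List using (_∷_)
open import Data.Nat using (ℕ; zero; suc)
open import Data.Product using (_×_; _,_; ∃-syntax; proj₁; proj₂)
open import Data.Empty using (⊥-elim)
open import Function using (_∘_)
open import Relation.Binary.Core using (_=[_]⇒_)
open import Relation.Binary.PropositionalEquality
  using (_≡_; refl; sym; trans; cong; cong₂; subst; subst₂)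
open import Relation.Binary.Construct.Closure.ReflexiveTransitive
  using (Star; ε; _◅_; _◅◅_; kleisliStar)
import Relation.Binary.Construct.Closure.ReflexiveTransitive as Star
open import Relation.Binary.Construct.Closure.Symmetric using (SymClosure; fwd; bwd)
import Relation.Binary.Construct.Closure.Equivalence as EqClosure

module Metatheory (P : PTS) where
  open PTS P
  open PTSDefs P

  variable
    Γ Δ : Ctx
    t t′ u u′ w A A′ B B′ C T T′ : Tm
    ρ ρ′ : ℕ → ℕ
    σ σ′ : ℕ → Tm
    s s′ s₁ s₂ s₃ : Sort

  ext-cong : (∀ n → ρ n ≡ ρ′ n) → ∀ n → ext ρ n ≡ ext ρ′ n
  ext-cong h zero    = refl
  ext-cong h (suc n) = cong suc (h n)

  ren-cong : (∀ n → ρ n ≡ ρ′ n) → ∀ t → ren ρ t ≡ ren ρ′ t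
  ren-cong h (var n)   = cong var (h n)
  ren-cong h (srt s)   = refl
  ren-cong h (Pi A B)  = cong₂ Pi (ren-cong h A) (ren-cong (ext-cong h) B)
  ren-cong h (lam A t) = cong₂ lam (ren-cong h A) (ren-cong (ext-cong h) t)
  ren-cong h (app t u) = cong₂ app (ren-cong h t) (ren-cong h u)

  ext-∘ : ∀ (ρ ρ′ : ℕ → ℕ) n → ext ρ (ext ρ′ n) ≡ ext (ρ ∘ ρ′) n
  ext-∘ ρ ρ′ zero    = refl
  ext-∘ ρ ρ′ (suc n) = refl

  ren-∘ : ∀ (ρ ρ′ : ℕ → ℕ) t → ren ρ (ren ρ′ t) ≡ ren (ρ ∘ ρ′) t
  ren-∘ ρ ρ′ (var n)   = refl
  ren-∘ ρ ρ′ (srt s)   = refl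
  ren-∘ ρ ρ′ (Pi A B)  =
    cong₂ Pi (ren-∘ ρ ρ′ A) (trans (ren-∘ (ext ρ) (ext ρ′) B) (ren-cong (ext-∘ ρ ρ′) B))
  ren-∘ ρ ρ′ (lam A t) =
    cong₂ lam (ren-∘ ρ ρ′ A) (trans (ren-∘ (ext ρ) (ext ρ′) t) (ren-cong (ext-∘ ρ ρ′) t))
  ren-∘ ρ ρ′ (app t u) = cong₂ app (ren-∘ ρ ρ′ t) (ren-∘ ρ ρ′ u)

  ren-ext-wk : ∀ (ρ : ℕ → ℕ) t → ren (ext ρ) (wk t) ≡ wk (ren ρ t)
  ren-ext-wk ρ t = trans (ren-∘ (ext ρ) suc t) (sym (ren-∘ suc ρ t))

  exts-cong : (∀ n → σ n ≡ σ′ n) → ∀ n → exts σ n ≡ exts σ′ n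
  exts-cong h zero    = refl
  exts-cong h (suc n) = cong wk (h n)

  sub-cong : (∀ n → σ n ≡ σ′ n) → ∀ t → sub σ t ≡ sub σ′ t
  sub-cong h (var n)   = h n
  sub-cong h (srt s)   = refl
  sub-cong h (Pi A B)  = cong₂ Pi (sub-cong h A) (sub-cong (exts-cong h) B)
  sub-cong h (lam A t) = cong₂ lam (sub-cong h A) (sub-cong (exts-cong h) t)
  sub-cong h (app t u) = cong₂ app (sub-cong h t) (sub-cong h u)

  exts-ext : ∀ (σ : ℕ → Tm) (ρ : ℕ → ℕ) n → exts σ (ext ρ n) ≡ exts (σ ∘ ρ) n
  exts-ext σ ρ zero    = refl
  exts-ext σ ρ (suc n) = refl

  sub-ren : ∀ (σ : ℕ → Tm) (ρ : ℕ → ℕ) t → sub σ (ren ρ t) ≡ sub (σ ∘ ρ) t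
  sub-ren σ ρ (var n)   = refl
  sub-ren σ ρ (srt s)   = refl
  sub-ren σ ρ (Pi A B)  =
    cong₂ Pi (sub-ren σ ρ A) (trans (sub-ren (exts σ) (ext ρ) B) (sub-cong (exts-ext σ ρ) B))
  sub-ren σ ρ (lam A t) =
    cong₂ lam (sub-ren σ ρ A) (trans (sub-ren (exts σ) (ext ρ) t) (sub-cong (exts-ext σ ρ) t))
  sub-ren σ ρ (app t u) = cong₂ app (sub-ren σ ρ t) (sub-ren σ ρ u)

  ren-exts : ∀ (ρ : ℕ → ℕ) (σ : ℕ → Tm) n → ren (ext ρ) (exts σ n) ≡ exts (ren ρ ∘ σ) n
  ren-exts ρ σ zero    = refl
  ren-exts ρ σ (suc n) = ren-ext-wk ρ (σ n)

  ren-sub : ∀ (ρ : ℕ → ℕ) (σ : ℕ → Tm) t → ren ρ (sub σ t) ≡ sub (ren ρ ∘ σ) t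
  ren-sub ρ σ (var n)   = refl
  ren-sub ρ σ (srt s)   = refl
  ren-sub ρ σ (Pi A B)  =
    cong₂ Pi (ren-sub ρ σ A) (trans (ren-sub (ext ρ) (exts σ) B) (sub-cong (ren-exts ρ σ) B))
  ren-sub ρ σ (lam A t) =
    cong₂ lam (ren-sub ρ σ A) (trans (ren-sub (ext ρ) (exts σ) t) (sub-cong (ren-exts ρ σ) t))
  ren-sub ρ σ (app t u) = cong₂ app (ren-sub ρ σ t) (ren-sub ρ σ u)

  sub-exts : ∀ (σ τ : ℕ → Tm) n → sub (exts σ) (exts τ n) ≡ exts (sub σ ∘ τ) n
  sub-exts σ τ zero    = refl
  sub-exts σ τ (suc n) = trans (sub-ren (exts σ) suc (τ n)) (sym (ren-sub suc σ (τ n)))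

  sub-sub : ∀ (σ τ : ℕ → Tm) t → sub σ (sub τ t) ≡ sub (sub σ ∘ τ) t
  sub-sub σ τ (var n)   = refl
  sub-sub σ τ (srt s)   = refl
  sub-sub σ τ (Pi A B)  =
    cong₂ Pi (sub-sub σ τ A) (trans (sub-sub (exts σ) (exts τ) B) (sub-cong (sub-exts σ τ) B))
  sub-sub σ τ (lam A t) =
    cong₂ lam (sub-sub σ τ A) (trans (sub-sub (exts σ) (exts τ) t) (sub-cong (sub-exts σ τ) t))
  sub-sub σ τ (app t u) = cong₂ app (sub-sub σ τ t) (sub-sub σ τ u)

  exts-id : (∀ n → σ n ≡ var n) → ∀ n → exts σ n ≡ var n
  exts-id h zero    = refl
  exts-id h (suc n) = cong wk (h n)

  sub-id : (∀ n → σ n ≡ var n) → ∀ t → sub σ t ≡ t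
  sub-id h (var n)   = h n
  sub-id h (srt s)   = refl
  sub-id h (Pi A B)  = cong₂ Pi (sub-id h A) (sub-id (exts-id h) B)
  sub-id h (lam A t) = cong₂ lam (sub-id h A) (sub-id (exts-id h) t)
  sub-id h (app t u) = cong₂ app (sub-id h t) (sub-id h u)

  ren-[] : ∀ (ρ : ℕ → ℕ) t u → ren ρ (t [ u ]) ≡ ren (ext ρ) t [ ren ρ u ]
  ren-[] ρ t u =
    trans (ren-sub ρ (sub0 u) t) (trans (sub-cong agree t) (sym (sub-ren (sub0 (ren ρ u)) (ext ρ) t)))
    where
    agree : ∀ n → ren ρ (sub0 u n) ≡ sub0 (ren ρ u) (ext ρ n)
    agree zero    = refl
    agree (suc n) = refl

  sub-[] : ∀ (σ : ℕ → Tm) t u → sub σ (t [ u ]) ≡ sub (exts σ) t [ sub σ u ]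
  sub-[] σ t u =
    trans (sub-sub σ (sub0 u) t) (trans (sub-cong agree t) (sym (sub-sub (sub0 (sub σ u)) (exts σ) t)))
    where
    agree : ∀ n → sub σ (sub0 u n) ≡ sub (sub0 (sub σ u)) (exts σ n)
    agree zero    = refl
    agree (suc n) = sym (trans (sub-ren (sub0 (sub σ u)) suc (σ n)) (sub-id (λ _ → refl) (σ n)))

  -- Parallel reduction and the Church–Rosser property

  infix 4 _⇉_ _⇉*_
  data _⇉_ : Tm → Tm → Set where
    ⇉var : ∀ {n} → var n ⇉ var n
    ⇉srt : srt s ⇉ srt s
    ⇉Pi  : A ⇉ A′ → B ⇉ B′ → Pi A B ⇉ Pi A′ B′
    ⇉lam : A ⇉ A′ → t ⇉ t′ → lam A t ⇉ lam A′ t′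
    ⇉app : t ⇉ t′ → u ⇉ u′ → app t u ⇉ app t′ u′
    ⇉β   : t ⇉ t′ → u ⇉ u′ → app (lam A t) u ⇉ t′ [ u′ ]

  _⇉*_ : Tm → Tm → Set
  _⇉*_ = Star _⇉_

  ⇉-refl : ∀ t → t ⇉ t
  ⇉-refl (var n)   = ⇉var
  ⇉-refl (srt s)   = ⇉srt
  ⇉-refl (Pi A B)  = ⇉Pi (⇉-refl A) (⇉-refl B)
  ⇉-refl (lam A t) = ⇉lam (⇉-refl A) (⇉-refl t)
  ⇉-refl (app t u) = ⇉app (⇉-refl t) (⇉-refl u)

  ren-⇉ : ∀ (ρ : ℕ → ℕ) → t ⇉ t′ → ren ρ t ⇉ ren ρ t′
  ren-⇉ ρ ⇉var       = ⇉var
  ren-⇉ ρ ⇉srt       = ⇉srt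
  ren-⇉ ρ (⇉Pi p q)  = ⇉Pi (ren-⇉ ρ p) (ren-⇉ (ext ρ) q)
  ren-⇉ ρ (⇉lam p q) = ⇉lam (ren-⇉ ρ p) (ren-⇉ (ext ρ) q)
  ren-⇉ ρ (⇉app p q) = ⇉app (ren-⇉ ρ p) (ren-⇉ ρ q)
  ren-⇉ ρ (⇉β {t′ = t′} {u′ = u′} p q) =
    subst (_ ⇉_) (sym (ren-[] ρ t′ u′)) (⇉β (ren-⇉ (ext ρ) p) (ren-⇉ ρ q))

  exts-⇉ : (∀ n → σ n ⇉ σ′ n) → ∀ n → exts σ n ⇉ exts σ′ n
  exts-⇉ h zero    = ⇉var
  exts-⇉ h (suc n) = ren-⇉ suc (h n)

  sub-⇉ : (∀ n → σ n ⇉ σ′ n) → t ⇉ t′ → sub σ t ⇉ sub σ′ t′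
  sub-⇉ h (⇉var {n}) = h n
  sub-⇉ h ⇉srt       = ⇉srt
  sub-⇉ h (⇉Pi p q)  = ⇉Pi (sub-⇉ h p) (sub-⇉ (exts-⇉ h) q)
  sub-⇉ h (⇉lam p q) = ⇉lam (sub-⇉ h p) (sub-⇉ (exts-⇉ h) q)
  sub-⇉ h (⇉app p q) = ⇉app (sub-⇉ h p) (sub-⇉ h q)
  sub-⇉ {σ′ = σ′} h (⇉β {t′ = t′} {u′ = u′} p q) =
    subst (_ ⇉_) (sym (sub-[] σ′ t′ u′)) (⇉β (sub-⇉ (exts-⇉ h) p) (sub-⇉ h q))

  []-⇉ : t ⇉ t′ → u ⇉ u′ → t [ u ] ⇉ t′ [ u′ ]
  []-⇉ {u = u} {u′ = u′} p q = sub-⇉ agree p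
    where
    agree : ∀ n → sub0 u n ⇉ sub0 u′ n
    agree zero    = q
    agree (suc n) = ⇉var

  develop : Tm → Tm
  develop (var n)           = var n
  develop (srt s)           = srt s
  develop (Pi A B)          = Pi (develop A) (develop B)
  develop (lam A t)         = lam (develop A) (develop t)
  develop (app (lam A t) u) = develop t [ develop u ]
  develop (app t u)         = app (develop t) (develop u)

  ⇉-develop : t ⇉ u → u ⇉ develop t
  ⇉-develop ⇉var       = ⇉var
  ⇉-develop ⇉srt       = ⇉srt
  ⇉-develop (⇉Pi p q)  = ⇉Pi (⇉-develop p) (⇉-develop q)
  ⇉-develop (⇉lam p q) = ⇉lam (⇉-develop p) (⇉-develop q)
  ⇉-develop (⇉app {t = var _} p q)     = ⇉app (⇉-develop p) (⇉-develop q)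
  ⇉-develop (⇉app {t = srt _} p q)     = ⇉app (⇉-develop p) (⇉-develop q)
  ⇉-develop (⇉app {t = Pi _ _} p q)    = ⇉app (⇉-develop p) (⇉-develop q)
  ⇉-develop (⇉app {t = app _ _} p q)   = ⇉app (⇉-develop p) (⇉-develop q)
  ⇉-develop (⇉app (⇉lam _ p) q)        = ⇉β (⇉-develop p) (⇉-develop q)
  ⇉-develop (⇉β p q)   = []-⇉ (⇉-develop p) (⇉-develop q)

  strip : t ⇉ u → t ⇉* w → ∃[ z ] u ⇉* z × w ⇉ z
  strip p ε = _ , ε , p
  strip p (q ◅ qs) with strip (⇉-develop q) qs
  ... | z , develop↠z , w⇉z = z , ⇉-develop p ◅ develop↠z , w⇉z

  →β⇒⇉ : t →β u → t ⇉ u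
  →β⇒⇉ β        = ⇉β (⇉-refl _) (⇉-refl _)
  →β⇒⇉ (Piˡ p)  = ⇉Pi (→β⇒⇉ p) (⇉-refl _)
  →β⇒⇉ (Piʳ p)  = ⇉Pi (⇉-refl _) (→β⇒⇉ p)
  →β⇒⇉ (lamˡ p) = ⇉lam (→β⇒⇉ p) (⇉-refl _)
  →β⇒⇉ (lamʳ p) = ⇉lam (⇉-refl _) (→β⇒⇉ p)
  →β⇒⇉ (appˡ p) = ⇉app (→β⇒⇉ p) (⇉-refl _)
  →β⇒⇉ (appʳ p) = ⇉app (⇉-refl _) (→β⇒⇉ p)

  ⇉⇒→β* : t ⇉ u → Star _→β_ t u
  ⇉⇒→β* ⇉var = ε
  ⇉⇒→β* ⇉srt = ε
  ⇉⇒→β* (⇉Pi {A′ = A′} {B = B} p q) =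
    Star.gmap (λ X → Pi X B) Piˡ (⇉⇒→β* p) ◅◅ Star.gmap (Pi A′) Piʳ (⇉⇒→β* q)
  ⇉⇒→β* (⇉lam {A′ = A′} {t = t} p q) =
    Star.gmap (λ X → lam X t) lamˡ (⇉⇒→β* p) ◅◅ Star.gmap (lam A′) lamʳ (⇉⇒→β* q)
  ⇉⇒→β* (⇉app {t′ = t′} {u = u} p q) =
    Star.gmap (λ X → app X u) appˡ (⇉⇒→β* p) ◅◅ Star.gmap (app t′) appʳ (⇉⇒→β* q)
  ⇉⇒→β* (⇉β {t′ = t′} {u = u} {A = A} p q) =
    Star.gmap (λ X → app (lam A X) u) (appˡ ∘ lamʳ) (⇉⇒→β* p) ◅◅
    Star.gmap (app (lam A t′)) appʳ (⇉⇒→β* q) ◅◅ β ◅ ε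

  ⇉⇒=β : t ⇉ u → t =β u
  ⇉⇒=β = Star.map fwd ∘ ⇉⇒→β*

  ⇉*⇒=β : t ⇉* u → t =β u
  ⇉*⇒=β = kleisliStar _ ⇉⇒=β

  =β-sym : t =β u → u =β t
  =β-sym = EqClosure.symmetric _→β_

  =β-preserved : (f : Tm → Tm) → (∀ {t u} → t ⇉ u → f t ⇉ f u) → t =β u → f t =β f u
  =β-preserved f f-⇉ = kleisliStar f step
    where
    step : SymClosure _→β_ =[ f ]⇒ _=β_
    step (fwd p) = ⇉⇒=β (f-⇉ (→β⇒⇉ p))
    step (bwd p) = =β-sym (⇉⇒=β (f-⇉ (→β⇒⇉ p)))

  ren-=β : ∀ (ρ : ℕ → ℕ) → t =β t′ → ren ρ t =β ren ρ t′
  ren-=β ρ = =β-preserved (ren ρ) (ren-⇉ ρ)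

  []-=β : ∀ u → t =β t′ → (t [ u ]) =β (t′ [ u ])
  []-=β u = =β-preserved (_[ u ]) (λ p → []-⇉ p (⇉-refl u))

  church-rosser : t =β u → ∃[ z ] t ⇉* z × u ⇉* z
  church-rosser ε = _ , ε , ε
  church-rosser (fwd p ◅ ps) with church-rosser ps
  ... | z , t′↠z , u↠z = z , →β⇒⇉ p ◅ t′↠z , u↠z
  church-rosser (bwd p ◅ ps) with church-rosser ps
  ... | z , t′↠z , u↠z with strip (→β⇒⇉ p) t′↠z
  ... | z′ , t↠z′ , z⇉z′ = z′ , t↠z′ , u↠z ◅◅ z⇉z′ ◅ ε

  srt-⇉* : srt s ⇉* w → w ≡ srt s
  srt-⇉* ε            = refl
  srt-⇉* (⇉srt ◅ ps) = srt-⇉* ps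

  srt-injective : srt s =β srt s′ → s ≡ s′
  srt-injective e with church-rosser e
  ... | _ , p , q with trans (sym (srt-⇉* p)) (srt-⇉* q)
  ... | refl = refl

  Pi-⇉* : Pi A B ⇉* w → ∃[ A′ ] ∃[ B′ ] w ≡ Pi A′ B′ × B ⇉* B′
  Pi-⇉* ε = _ , _ , refl , ε
  Pi-⇉* (⇉Pi _ q ◅ ps) with Pi-⇉* ps
  ... | A′ , B′ , refl , qs = A′ , B′ , refl , q ◅ qs

  Pi-injectiveʳ : Pi A B =β Pi A′ B′ → B =β B′
  Pi-injectiveʳ e with church-rosser e
  ... | _ , p , q with Pi-⇉* p | Pi-⇉* q
  ... | _ , _ , refl , B↠ | _ , _ , refl , B′↠ =
    ⇉*⇒=β B↠ ◅◅ =β-sym (⇉*⇒=β B′↠)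

  -- Thinning and generation

  data Insert : (ℕ → ℕ) → Ctx → Ctx → Set where
    insert-here  : Γ ⊢ C ∶ srt s → Insert suc Γ (C ∷ Γ)
    insert-under : Insert ρ Γ Δ → Insert (ext ρ) (A ∷ Γ) (ren ρ A ∷ Δ)

  thinning : Γ ⊢ t ∶ T → Insert ρ Γ Δ → Δ ⊢ ren ρ t ∶ ren ρ T
  thinning d (insert-here ⊢C) = ⊢weak d ⊢C
  thinning (⊢start {A = A} d) (insert-under {ρ = ρ} {Δ = Δ} i) =
    subst ((ren ρ A ∷ Δ) ⊢ var zero ∶_) (sym (ren-ext-wk ρ A)) (⊢start (thinning d i))
  thinning (⊢weak {t = t} {T = T} {C = C} d ⊢C) (insert-under {ρ = ρ} {Δ = Δ} i) =
    subst₂ ((ren ρ C ∷ Δ) ⊢_∶_) (sym (ren-ext-wk ρ t)) (sym (ren-ext-wk ρ T))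
      (⊢weak (thinning d i) (thinning ⊢C i))
  thinning (⊢prod r ⊢A ⊢B) i = ⊢prod r (thinning ⊢A i) (thinning ⊢B (insert-under i))
  thinning {ρ = ρ} {Δ = Δ} (⊢app {f = f} {u = u} {B = B} d e) i =
    subst (Δ ⊢ app (ren ρ f) (ren ρ u) ∶_) (sym (ren-[] ρ B u))
      (⊢app (thinning d i) (thinning e i))
  thinning (⊢abs d e) i = ⊢abs (thinning d (insert-under i)) (thinning e i)
  thinning {ρ = ρ} (⊢conv d e c) i = ⊢conv (thinning d i) (thinning e i) (ren-=β ρ c)

  infix 4 _∋_∶_
  data _∋_∶_ : Ctx → ℕ → Tm → Set where
    here  : A ∷ Γ ∋ zero ∶ wk A
    there : ∀ {n} → Γ ∋ n ∶ A → C ∷ Γ ∋ suc n ∶ wk A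

  ∋-functional : ∀ {n} → Γ ∋ n ∶ A → Γ ∋ n ∶ B → A ≡ B
  ∋-functional here      here       = refl
  ∋-functional (there l) (there l′) = cong wk (∋-functional l l′)

  -- The subject is passed as an equation because that of ⊢weak, wk t, is not a constructor form.

  ⊢var-inv : ∀ {n} → Γ ⊢ t ∶ T → t ≡ var n → ∃[ A ] Γ ∋ n ∶ A × A =β T
  ⊢var-inv (⊢start d) refl = _ , here , ε
  ⊢var-inv (⊢weak {t = var _} d _) refl with ⊢var-inv d refl
  ... | A , l , e = wk A , there l , ren-=β suc e
  ⊢var-inv (⊢weak {t = srt _} d _) ()
  ⊢var-inv (⊢weak {t = Pi _ _} d _) ()
  ⊢var-inv (⊢weak {t = lam _ _} d _) ()
  ⊢var-inv (⊢weak {t = app _ _} d _) ()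
  ⊢var-inv (⊢conv d _ c) eq with ⊢var-inv d eq
  ... | A , l , e = A , l , e ◅◅ c

  ⊢srt-inv : Γ ⊢ t ∶ T → t ≡ srt s → ∃[ s′ ] Ax s s′ × srt s′ =β T
  ⊢srt-inv (⊢ax a) refl = _ , a , ε
  ⊢srt-inv (⊢weak {t = srt _} d _) refl with ⊢srt-inv d refl
  ... | s′ , a , e = s′ , a , ren-=β suc e
  ⊢srt-inv (⊢weak {t = var _} d _) ()
  ⊢srt-inv (⊢weak {t = Pi _ _} d _) ()
  ⊢srt-inv (⊢weak {t = lam _ _} d _) ()
  ⊢srt-inv (⊢weak {t = app _ _} d _) ()
  ⊢srt-inv (⊢conv d _ c) eq with ⊢srt-inv d eq
  ... | s′ , a , e = s′ , a , e ◅◅ c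

  ⊢Pi-inv : Γ ⊢ t ∶ T → t ≡ Pi A B →
            ∃[ s₁ ] ∃[ s₂ ] ∃[ s₃ ]
              Rl s₁ s₂ s₃ × Γ ⊢ A ∶ srt s₁ × (A ∷ Γ) ⊢ B ∶ srt s₂ × srt s₃ =β T
  ⊢Pi-inv (⊢prod r ⊢A ⊢B) refl = _ , _ , _ , r , ⊢A , ⊢B , ε
  ⊢Pi-inv (⊢weak {t = Pi _ _} d ⊢C) refl with ⊢Pi-inv d refl
  ... | s₁ , s₂ , s₃ , r , ⊢A , ⊢B , e =
    s₁ , s₂ , s₃ , r , ⊢weak ⊢A ⊢C , thinning ⊢B (insert-under (insert-here ⊢C)) , ren-=β suc e
  ⊢Pi-inv (⊢weak {t = var _} d _) ()
  ⊢Pi-inv (⊢weak {t = srt _} d _) ()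
  ⊢Pi-inv (⊢weak {t = lam _ _} d _) ()
  ⊢Pi-inv (⊢weak {t = app _ _} d _) ()
  ⊢Pi-inv (⊢conv d _ c) eq with ⊢Pi-inv d eq
  ... | s₁ , s₂ , s₃ , r , ⊢A , ⊢B , e = s₁ , s₂ , s₃ , r , ⊢A , ⊢B , e ◅◅ c

  ⊢lam-inv : Γ ⊢ t ∶ T → t ≡ lam A u → ∃[ B ] (A ∷ Γ) ⊢ u ∶ B × Pi A B =β T
  ⊢lam-inv (⊢abs d _) refl = _ , d , ε
  ⊢lam-inv (⊢weak {t = lam _ _} d ⊢C) refl with ⊢lam-inv d refl
  ... | B , ⊢u , e = ren (ext suc) B , thinning ⊢u (insert-under (insert-here ⊢C)) , ren-=β suc e
  ⊢lam-inv (⊢weak {t = var _} d _) ()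
  ⊢lam-inv (⊢weak {t = srt _} d _) ()
  ⊢lam-inv (⊢weak {t = Pi _ _} d _) ()
  ⊢lam-inv (⊢weak {t = app _ _} d _) ()
  ⊢lam-inv (⊢conv d _ c) eq with ⊢lam-inv d eq
  ... | B , ⊢u , e = B , ⊢u , e ◅◅ c

  ⊢app-inv : Γ ⊢ t ∶ T → t ≡ app w u → ∃[ A ] ∃[ B ] Γ ⊢ w ∶ Pi A B × (B [ u ]) =β T
  ⊢app-inv (⊢app d _) refl = _ , _ , d , ε
  ⊢app-inv (⊢weak {t = app _ u} d ⊢C) refl with ⊢app-inv d refl
  ... | A , B , ⊢w , e =
    wk A , ren (ext suc) B , ⊢weak ⊢w ⊢C , subst (_=β _) (ren-[] suc B u) (ren-=β suc e)
  ⊢app-inv (⊢weak {t = var _} d _) ()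
  ⊢app-inv (⊢weak {t = srt _} d _) ()
  ⊢app-inv (⊢weak {t = Pi _ _} d _) ()
  ⊢app-inv (⊢weak {t = lam _ _} d _) ()
  ⊢app-inv (⊢conv d _ c) eq with ⊢app-inv d eq
  ... | A , B , ⊢w , e = A , B , ⊢w , e ◅◅ c

  Lexts-cancels-ext : {σ : ℕ → LTm} → (∀ n → σ (ρ n) ≡ v n) → ∀ n → Lexts σ (ext ρ n) ≡ v n
  Lexts-cancels-ext h zero    = refl
  Lexts-cancels-ext h (suc n) = cong Lwk (h n)

  Lsub-cancels-Lren : {σ : ℕ → LTm} → (∀ n → σ (ρ n) ≡ v n) → ∀ t → Lsub σ (Lren ρ t) ≡ t
  Lsub-cancels-Lren h (v n)      = h n
  Lsub-cancels-Lren h Ty         = refl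
  Lsub-cancels-Lren h Kd         = refl
  Lsub-cancels-Lren h (cU s)     = refl
  Lsub-cancels-Lren h (cε s)     = refl
  Lsub-cancels-Lren h (cdot s)   = refl
  Lsub-cancels-Lren h (cΠ _ _ _) = refl
  Lsub-cancels-Lren h (LPi A B)  =
    cong₂ LPi (Lsub-cancels-Lren h A) (Lsub-cancels-Lren (Lexts-cancels-ext h) B)
  Lsub-cancels-Lren h (Llam A t) =
    cong₂ Llam (Lsub-cancels-Lren h A) (Lsub-cancels-Lren (Lexts-cancels-ext h) t)
  Lsub-cancels-Lren h (t · u)    = cong₂ _·_ (Lsub-cancels-Lren h t) (Lsub-cancels-Lren h u)

  Lwk-Llam·v0⟶body : ∀ A b → Lwk (Llam A b) · v zero ⟶ b
  Lwk-Llam·v0⟶body A b = subst (Lwk (Llam A b) · v zero ⟶_) (Lsub-cancels-Lren fresh b) βL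
    where
    fresh : ∀ n → Lsub0 (v zero) (ext suc n) ≡ v n
    fresh zero    = refl
    fresh (suc n) = refl

  ε-Π̇-≡P : ∀ {a b} → Rl s₁ s₂ s₃ →
           (cε s₃ · (cΠ s₁ s₂ s₃ · a · Llam (cε s₁ · a) b)) ≡P LPi (cε s₁ · a) (cε s₂ · b)
  ε-Π̇-≡P {a = a} {b} r = fwd (rRl r) ◅ fwd (LPiʳ (·ʳ (Lwk-Llam·v0⟶body (cε _ · a) b))) ◅ ε

  -- Uniqueness of types

  module _ (functional : Functional P) where
    ⊢-unique : ∀ t → Γ ⊢ t ∶ T → Γ ⊢ t ∶ T′ → T =β T′
    ⊢-unique (var n) d d′ with ⊢var-inv d refl | ⊢var-inv d′ refl
    ... | _ , l , e | _ , l′ , e′ with ∋-functional l l′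
    ... | refl = =β-sym e ◅◅ e′
    ⊢-unique (srt s) d d′ with ⊢srt-inv d refl | ⊢srt-inv d′ refl
    ... | _ , a , e | _ , a′ , e′ with proj₁ functional a a′
    ... | refl = =β-sym e ◅◅ e′
    ⊢-unique (Pi A B) d d′ with ⊢Pi-inv d refl | ⊢Pi-inv d′ refl
    ... | _ , _ , _ , r , ⊢A , ⊢B , e | _ , _ , _ , r′ , ⊢A′ , ⊢B′ , e′
      with srt-injective (⊢-unique A ⊢A ⊢A′) | srt-injective (⊢-unique B ⊢B ⊢B′)
    ... | refl | refl with proj₂ functional r r′
    ... | refl = =β-sym e ◅◅ e′
    ⊢-unique (lam A u) d d′ with ⊢lam-inv d refl | ⊢lam-inv d′ refl
    ... | _ , ⊢u , e | _ , ⊢u′ , e′ =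
      =β-sym e ◅◅ EqClosure.gmap (Pi A) Piʳ (⊢-unique u ⊢u ⊢u′) ◅◅ e′
    ⊢-unique (app w u) d d′ with ⊢app-inv d refl | ⊢app-inv d′ refl
    ... | _ , _ , ⊢w , e | _ , _ , ⊢w′ , e′ =
      =β-sym e ◅◅ []-=β u (Pi-injectiveʳ (⊢-unique w ⊢w ⊢w′)) ◅◅ e′

    sort-unique : Γ ⊢ A ∶ srt s → Γ ⊢ A ∶ srt s′ → s ≡ s′
    sort-unique {A = A} d d′ = srt-injective (⊢-unique A d d′)

    Tr-functional : ∀ {x y} → Tr Γ t x → Tr Γ t y → x ≡ y
    Tr-functional trVar trVar = refl
    Tr-functional trSrt trSrt = refl
    Tr-functional (trPi ⊢A ⊢B ⊢Π trA trB) (trPi ⊢A′ ⊢B′ ⊢Π′ trA′ trB′)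
      with sort-unique ⊢A ⊢A′ | sort-unique ⊢B ⊢B′ | sort-unique ⊢Π ⊢Π′
         | Tr-functional trA trA′ | Tr-functional trB trB′
    ... | refl | refl | refl | refl | refl = refl
    Tr-functional (trLam ⊢A trA trt) (trLam ⊢A′ trA′ trt′)
      with sort-unique ⊢A ⊢A′ | Tr-functional trA trA′ | Tr-functional trt trt′
    ... | refl | refl | refl = refl
    Tr-functional (trApp trt tru) (trApp trt′ tru′) =
      cong₂ _·_ (Tr-functional trt trt′) (Tr-functional tru tru′)

    Norm-unique : ∀ {x n} → Γ ⊢ A ∶ srt s → Tr Γ A x → Norm Γ A n → n ≡ cε s · x
    Norm-unique ⊢A trA (nmTy ⊢A′ trA′) with sort-unique ⊢A′ ⊢A | Tr-functional trA′ trA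
    ... | refl | refl = refl
    Norm-unique ⊢s _ (nmSrt untypable) with ⊢srt-inv ⊢s refl
    ... | s′ , a , _ = ⊥-elim (untypable s′ a)

    Pi-rule : Γ ⊢ A ∶ srt s₁ → (A ∷ Γ) ⊢ B ∶ srt s₂ → Γ ⊢ Pi A B ∶ srt s₃ → Rl s₁ s₂ s₃
    Pi-rule ⊢A ⊢B ⊢Π with ⊢Pi-inv ⊢Π refl
    ... | _ , _ , _ , r , ⊢A′ , ⊢B′ , e
      with sort-unique ⊢A′ ⊢A | sort-unique ⊢B′ ⊢B | srt-injective e
    ... | refl | refl | refl = r

open PTSDefs using (nmTy; trPi)
open Metatheory using (sort-unique; Norm-unique; Pi-rule; ε-Π̇-≡P)

proposition2 : (P : PTS) → Functional P →
    let open PTSDefs P in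
    ∀ {Γ A B C} → Γ ⊢ Pi A B ∶ C →
    ∀ {n a b} → Norm Γ (Pi A B) n → Norm Γ A a → Norm (A ∷ Γ) B b →
    n ≡P LPi a b
proposition2 P F _ (nmTy ⊢Π (trPi ⊢A ⊢B ⊢Π′ trA trB)) normA normB
  with sort-unique P F ⊢Π ⊢Π′ | Norm-unique P F ⊢A trA normA | Norm-unique P F ⊢B trB normB
... | refl | refl | refl = ε-Π̇-≡P P (Pi-rule P F ⊢A ⊢B ⊢Π′)
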